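{- Let $D=(V,A)$ be an oriented graph. If ${\rm tt}(D)<|A|$, then $D$ has a Sullivan vertex, i.e. a vertex $u$ with $|N^{++}(u)|\ge |N^-(u)|$.
   Context: An oriented graph is a loopless digraph in which $xy\in A$ implies $yx\notin A$. $N^-(u)=\{v: vu\in A\}$, $N^+(u)=\{v:uv\in A\}$, $N^{++}(u)=\{v\in V: uw,wv\in A \text{ for some } w\}\setminus N^+(u)$. A transitive triangle is an orientation of $K_3$ having a source (a vertex dominating the other two); ${\rm tt}(D)$ denotes the number of transitive triangles in $D$ (i.e. the number of 3-vertex sets inducing a transitive triangle). -}

module Defs where

open import Data.Nat using (ℕ; _<_; _≤_; _+_; zero; suc)
open import Data.Fin using (Fin)
open import Data.Fin.Properties using (_<?_)
open import Data.Bool using (Bool; true; false; _∧_; _∨_; not; T)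
open import Data.List using (List; length; filter; allFin; map)
open import Data.Nat.ListAction using (sum)
open import Data.Bool.ListAction using (any)
open import Relation.Binary.PropositionalEquality using (_≡_)
open import Relation.Nullary.Decidable using (⌊_⌋; T?)

record Digraph (n : ℕ) : Set where
  field
    arc : Fin n → Fin n → Bool

open Digraph public

record IsOriented {n : ℕ} (D : Digraph n) : Set where
  field
    loopless : ∀ x → arc D x x ≡ false
    antisym  : ∀ x y → T (arc D x y) → arc D y x ≡ false

count : {n : ℕ} → (Fin n → Bool) → ℕ
count {n} p = length (filter (λ x → T? (p x)) (allFin n))

sumV : {n : ℕ} → (Fin n → ℕ) → ℕ
sumV {n} f = sum (map f (allFin n))

numArcs : {n : ℕ} → Digraph n → ℕ
numArcs D = sumV (λ x → count (λ y → arc D x y))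

inDeg : {n : ℕ} → Digraph n → Fin n → ℕ
inDeg D u = count (λ v → arc D v u)

inN⁺⁺ : {n : ℕ} → Digraph n → Fin n → Fin n → Bool
inN⁺⁺ {n} D u v =
  any (λ w → arc D u w ∧ arc D w v) (allFin n) ∧ not (arc D u v)

secondOutDeg : {n : ℕ} → Digraph n → Fin n → ℕ
secondOutDeg D u = count (inN⁺⁺ D u)

dominates : {n : ℕ} → Digraph n → Fin n → Fin n → Fin n → Bool
dominates D x y z = arc D x y ∧ arc D x z

adj : {n : ℕ} → Digraph n → Fin n → Fin n → Bool
adj D x y = arc D x y ∨ arc D y x

-- the 3-set {a,b,c} induces a transitive triangle: an orientation of K₃
-- (all three pairs adjacent) having a source
isTT : {n : ℕ} → Digraph n → Fin n → Fin n → Fin n → Bool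
isTT D a b c =
  (adj D a b ∧ adj D a c ∧ adj D b c) ∧
  (dominates D a b c ∨ dominates D b a c ∨ dominates D c a b)

tt : {n : ℕ} → Digraph n → ℕ
tt D = sumV (λ a → sumV (λ b → count (λ c →
         ⌊ a <? b ⌋ ∧ ⌊ b <? c ⌋ ∧ isTT D a b c)))

IsSullivan : {n : ℕ} → Digraph n → Fin n → Set
IsSullivan D u = inDeg D u ≤ secondOutDeg D u

-- Suppose no vertex is a Sullivan vertex. For an arc uw, every out-neighbour of w
-- is either an out-neighbour of u or lies in N⁺⁺(u), so
--   d⁺(w) ≤ |N⁺(u) ∩ N⁺(w)| + |N⁺⁺(u)| < |N⁺(u) ∩ N⁺(w)| + d⁻(u).
-- Summed over all arcs uw, the terms d⁺(w) and d⁻(u) both add up to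
-- Σ_v d⁻(v) d⁺(v) and cancel, leaving |A| ≤ Σ_{uw ∈ A} |N⁺(u) ∩ N⁺(w)|: the number
-- of triples (u, w, x) with uw, ux, wx ∈ A. In an oriented graph each transitive
-- triangle arises from exactly one such triple, so this number is at most tt(D).
module Submission where

open import Defs
open import Data.Nat using (ℕ; _<_)
open import Data.Fin using (Fin)
open import Data.Product using (∃)

open import Data.Bool using (Bool; true; false; _∧_; T)
open import Data.Bool.Properties using (∧-assoc; ∨-zeroʳ)
import Data.Bool.Properties as Bool
open import Data.Bool.ListAction using (any)
open import Data.Empty using (⊥-elim)
open import Data.Fin.Patterns using (0F; 1F; 2F)
open import Data.Fin.Properties using (_<?_; <-cmp; any?)
import Data.Fin as Fin
open import Data.Fin.Subset using (Subset)
open import Data.Fin.Subset.Properties using (anySubset?)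
open import Data.List using (List; []; _∷_; map; filter; length; tabulate; allFin)
import Data.Nat.ListAction as List
open import Data.List.Properties using (map-tabulate)
open import Data.List.Membership.Propositional using (_∈_)
open import Data.List.Membership.Propositional.Properties using (∈-allFin)
open import Data.List.Relation.Unary.Any using (here; there)
open import Data.Nat using (zero; suc; _+_; _*_; _≤_; z≤n; s≤s; _≤?_)
open import Data.Nat.Properties hiding (_<?_; <-cmp)
open import Algebra.Properties.Semiring.Sum +-*-semiring
  using (sum-syntax; sum-cong-≗; ∑-comm; ∑-distrib-+; *-distribˡ-sum; *-distribʳ-sum)
open import Data.Nat.Solver using (module +-*-Solver)
open import Data.Product using (_,_)
open import Data.Vec using (Vec; []; _∷_)
open import Function using (_∘_)
open import Relation.Binary.Definitions using (tri<; tri≈; tri>)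
open import Relation.Binary.PropositionalEquality
open import Relation.Nullary using (Dec; yes; no)
open import Relation.Nullary.Decidable using (⌊_⌋; T?; map′; ¬?; _→-dec_; from-yes; decidable-stable; dec-true; isYes≗does)
open import Relation.Unary using (Decidable)

private
  variable
    n : ℕ

⟦_⟧ : Bool → ℕ
⟦ true ⟧ = 1
⟦ false ⟧ = 0

⟦∧⟧≡* : ∀ x y → ⟦ x ∧ y ⟧ ≡ ⟦ x ⟧ * ⟦ y ⟧
⟦∧⟧≡* true y = sym (+-identityʳ ⟦ y ⟧)
⟦∧⟧≡* false y = refl

⟦⟧*-monoʳ-≤ : ∀ b {m m′} → (b ≡ true → m ≤ m′) → ⟦ b ⟧ * m ≤ ⟦ b ⟧ * m′
⟦⟧*-monoʳ-≤ true m≤m′ = +-monoˡ-≤ 0 (m≤m′ refl)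
⟦⟧*-monoʳ-≤ false _ = z≤n

⟦⟧*-≤-⟦∧⟧ : ∀ x y {m} → m ≤ ⟦ y ⟧ → ⟦ x ⟧ * m ≤ ⟦ x ∧ y ⟧
⟦⟧*-≤-⟦∧⟧ true y m≤y = ≤-trans (≤-reflexive (+-identityʳ _)) m≤y
⟦⟧*-≤-⟦∧⟧ false y _ = z≤n

any-∈ : {A : Set} (p : A → Bool) {x : A} {xs : List A} → x ∈ xs → p x ≡ true → any p xs ≡ true
any-∈ p (here refl) px rewrite px = refl
any-∈ p {xs = y ∷ _} (there x∈xs) px rewrite any-∈ p x∈xs px = ∨-zeroʳ (p y)

∀-Subset? : ∀ {k} {P : Subset k → Set} → Decidable P → Dec (∀ v → P v)
∀-Subset? P? = map′ (λ ∄¬P v → decidable-stable (P? v) (λ ¬Pv → ∄¬P (v , ¬Pv)))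
                    (λ ∀P (v , ¬Pv) → ¬Pv (∀P v))
                    (¬? (anySubset? (¬? ∘ P?)))

sum-tabulate : (f : Fin n → ℕ) → List.sum (tabulate f) ≡ ∑[ i < n ] f i
sum-tabulate {zero} f = refl
sum-tabulate {suc n} f = cong (f 0F +_) (sum-tabulate (f ∘ Fin.suc))

sumV≡∑ : (f : Fin n → ℕ) → sumV f ≡ ∑[ i < n ] f i
sumV≡∑ {n} f = trans (cong List.sum (map-tabulate (λ i → i) f)) (sum-tabulate f)

length-filter≡sum : {A : Set} (p : A → Bool) (xs : List A) →
  length (filter (T? ∘ p) xs) ≡ List.sum (map (⟦_⟧ ∘ p) xs)
length-filter≡sum p [] = refl
length-filter≡sum p (x ∷ xs) with p x
... | true = cong suc (length-filter≡sum p xs)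
... | false = length-filter≡sum p xs

count≡∑ : (p : Fin n → Bool) → count p ≡ ∑[ i < n ] ⟦ p i ⟧
count≡∑ {n} p = trans (length-filter≡sum p (allFin n)) (sumV≡∑ (⟦_⟧ ∘ p))

∑-mono-≤ : {f g : Fin n → ℕ} → (∀ i → f i ≤ g i) → ∑[ i < n ] f i ≤ ∑[ i < n ] g i
∑-mono-≤ {zero} f≤g = z≤n
∑-mono-≤ {suc n} f≤g = +-mono-≤ (f≤g 0F) (∑-mono-≤ (f≤g ∘ Fin.suc))

-- Opaque, so that a constraint ∑³ h ≡ ∑³ k is solved by unifying h with k.
opaque
  ∑³ : (Fin n → Fin n → Fin n → ℕ) → ℕ
  ∑³ {n} h = ∑[ a < n ] ∑[ b < n ] ∑[ c < n ] h a b c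

  ∑³-unfold : (h : Fin n → Fin n → Fin n → ℕ) → ∑³ h ≡ ∑[ a < n ] ∑[ b < n ] ∑[ c < n ] h a b c
  ∑³-unfold h = refl

  ∑³-cong : {h k : Fin n → Fin n → Fin n → ℕ} → (∀ a b c → h a b c ≡ k a b c) → ∑³ h ≡ ∑³ k
  ∑³-cong h≡k = sum-cong-≗ λ a → sum-cong-≗ λ b → sum-cong-≗ (h≡k a b)

  ∑³-mono-≤ : {h k : Fin n → Fin n → Fin n → ℕ} → (∀ a b c → h a b c ≤ k a b c) → ∑³ h ≤ ∑³ k
  ∑³-mono-≤ h≤k = ∑-mono-≤ λ a → ∑-mono-≤ λ b → ∑-mono-≤ (h≤k a b)

  ∑³-distrib-+ : (h k : Fin n → Fin n → Fin n → ℕ) →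
    ∑³ (λ a b c → h a b c + k a b c) ≡ ∑³ h + ∑³ k
  ∑³-distrib-+ {n} h k = trans
    (sum-cong-≗ λ a → trans (sum-cong-≗ λ b → ∑-distrib-+ (h a b) (k a b))
                            (∑-distrib-+ (λ b → ∑[ c < n ] h a b c) (λ b → ∑[ c < n ] k a b c)))
    (∑-distrib-+ (λ a → ∑[ b < n ] ∑[ c < n ] h a b c) (λ a → ∑[ b < n ] ∑[ c < n ] k a b c))

  ∑³-bac : (h : Fin n → Fin n → Fin n → ℕ) → ∑³ h ≡ ∑³ (λ a b c → h b a c)
  ∑³-bac {n} h = ∑-comm λ a b → ∑[ c < n ] h a b c

  ∑³-acb : (h : Fin n → Fin n → Fin n → ℕ) → ∑³ h ≡ ∑³ (λ a b c → h a c b)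
  ∑³-acb h = sum-cong-≗ λ a → ∑-comm (h a)

∑³-cab : (h : Fin n → Fin n → Fin n → ℕ) → ∑³ h ≡ ∑³ (λ a b c → h c a b)
∑³-cab h = trans (∑³-bac h) (∑³-acb _)

∑³-bca : (h : Fin n → Fin n → Fin n → ℕ) → ∑³ h ≡ ∑³ (λ a b c → h b c a)
∑³-bca h = trans (∑³-acb h) (∑³-bac _)

∑³-cba : (h : Fin n → Fin n → Fin n → ℕ) → ∑³ h ≡ ∑³ (λ a b c → h c b a)
∑³-cba h = trans (∑³-bac h) (∑³-bca _)

orderings : (Fin n → Fin n → Fin n → ℕ) → Fin n → Fin n → Fin n → ℕ
orderings h a b c = h a b c + (h a c b + (h b a c + (h c b a + (h b c a + h c a b))))

module _ (h : Fin n → Fin n → Fin n → ℕ) (a b c : Fin n) where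
  open +-*-Solver

  summand≤orderings : h a b c ≤ orderings h a b c
  summand≤orderings = m≤m+n (h a b c) _

  orderings-bac : orderings h a b c ≡ orderings h b a c
  orderings-bac = solve 6 (λ x₁ x₂ x₃ x₄ x₅ x₆ →
    x₁ :+ (x₂ :+ (x₃ :+ (x₄ :+ (x₅ :+ x₆)))) := x₃ :+ (x₅ :+ (x₁ :+ (x₆ :+ (x₂ :+ x₄)))))
    refl (h a b c) (h a c b) (h b a c) (h c b a) (h b c a) (h c a b)

  orderings-acb : orderings h a b c ≡ orderings h a c b
  orderings-acb = solve 6 (λ x₁ x₂ x₃ x₄ x₅ x₆ →
    x₁ :+ (x₂ :+ (x₃ :+ (x₄ :+ (x₅ :+ x₆)))) := x₂ :+ (x₁ :+ (x₆ :+ (x₅ :+ (x₄ :+ x₃)))))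
    refl (h a b c) (h a c b) (h b a c) (h c b a) (h b c a) (h c a b)

∑³-*-orderings : (f g : Fin n → Fin n → Fin n → ℕ) →
  ∑³ (λ a b c → f a b c * orderings g a b c) ≡
  ∑³ (λ a b c → f a b c * g a b c) + (∑³ (λ a b c → f a b c * g a c b) +
  (∑³ (λ a b c → f a b c * g b a c) + (∑³ (λ a b c → f a b c * g c b a) +
  (∑³ (λ a b c → f a b c * g b c a) + ∑³ (λ a b c → f a b c * g c a b)))))
∑³-*-orderings f g = trans
  (∑³-cong λ a b c → distrib (f a b c) (g a b c) (g a c b) (g b a c) (g c b a) (g b c a) (g c a b))
  (trans (∑³-distrib-+ (λ a b c → f a b c * g a b c) _) (cong (∑³ (λ a b c → f a b c * g a b c) +_)
  (trans (∑³-distrib-+ (λ a b c → f a b c * g a c b) _) (cong (∑³ (λ a b c → f a b c * g a c b) +_)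
  (trans (∑³-distrib-+ (λ a b c → f a b c * g b a c) _) (cong (∑³ (λ a b c → f a b c * g b a c) +_)
  (trans (∑³-distrib-+ (λ a b c → f a b c * g c b a) _) (cong (∑³ (λ a b c → f a b c * g c b a) +_)
  (∑³-distrib-+ (λ a b c → f a b c * g b c a) _)))))))))
  where
  open +-*-Solver
  distrib : ∀ x y₁ y₂ y₃ y₄ y₅ y₆ →
    x * (y₁ + (y₂ + (y₃ + (y₄ + (y₅ + y₆))))) ≡
    x * y₁ + (x * y₂ + (x * y₃ + (x * y₄ + (x * y₅ + x * y₆))))
  distrib = solve 7 (λ x y₁ y₂ y₃ y₄ y₅ y₆ →
    x :* (y₁ :+ (y₂ :+ (y₃ :+ (y₄ :+ (y₅ :+ y₆))))) :=
    x :* y₁ :+ (x :* y₂ :+ (x :* y₃ :+ (x :* y₄ :+ (x :* y₅ :+ x :* y₆))))) refl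

-- ∑³ (f · g ∘ σ) = ∑³ (g · f ∘ σ⁻¹) for each of the six orderings σ; inverting σ fixes the
-- transpositions and exchanges the two 3-cycles.
∑³-*-orderings-comm : (f g : Fin n → Fin n → Fin n → ℕ) →
  ∑³ (λ a b c → f a b c * orderings g a b c) ≡ ∑³ (λ a b c → g a b c * orderings f a b c)
∑³-*-orderings-comm f g = trans (∑³-*-orderings f g) (trans
  (cong₂ _+_ (∑³-cong λ a b c → *-comm (f a b c) _)
  (cong₂ _+_ (trans (∑³-acb _) (∑³-cong λ a b c → *-comm (f a c b) _))
  (cong₂ _+_ (trans (∑³-bac _) (∑³-cong λ a b c → *-comm (f b a c) _))
  (cong₂ _+_ (trans (∑³-cba _) (∑³-cong λ a b c → *-comm (f c b a) _))
  (trans (cong₂ _+_ (trans (∑³-cab _) (∑³-cong λ a b c → *-comm (f c a b) _))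
                    (trans (∑³-bca _) (∑³-cong λ a b c → *-comm (f b c a) _)))
         (+-comm (∑³ (λ a b c → g a b c * f c a b)) (∑³ (λ a b c → g a b c * f b c a))))))))
  (sym (∑³-*-orderings g f)))

sorted : Fin n → Fin n → Fin n → ℕ
sorted a b c = ⟦ ⌊ a <? b ⌋ ∧ ⌊ b <? c ⌋ ⟧

⌊<?⌋-true : {x y : Fin n} → x Fin.< y → ⌊ x <? y ⌋ ≡ true
⌊<?⌋-true {x = x} {y} x<y = trans (isYes≗does (x <? y)) (dec-true (x <? y) x<y)

orderings-sorted-increasing : {a b c : Fin n} → a Fin.< b → b Fin.< c → 1 ≤ orderings sorted a b c
orderings-sorted-increasing {a = a} {b} {c} a<b b<c = ≤-trans
  (≤-reflexive (sym (cong₂ (λ x y → ⟦ x ∧ y ⟧) (⌊<?⌋-true a<b) (⌊<?⌋-true b<c))))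
  (summand≤orderings sorted a b c)

orderings-sorted-pos : {a b c : Fin n} → a ≢ b → a ≢ c → b ≢ c → 1 ≤ orderings sorted a b c
orderings-sorted-pos {a = a} {b} {c} a≢b a≢c b≢c with <-cmp a b | <-cmp b c | <-cmp a c
... | tri≈ _ a≡b _ | _ | _ = ⊥-elim (a≢b a≡b)
... | _ | tri≈ _ b≡c _ | _ = ⊥-elim (b≢c b≡c)
... | _ | _ | tri≈ _ a≡c _ = ⊥-elim (a≢c a≡c)
... | tri< a<b _ _ | tri< b<c _ _ | _ = orderings-sorted-increasing a<b b<c
... | tri< a<b _ _ | tri> _ _ c<b | tri< a<c _ _ =
  subst (1 ≤_) (sym (orderings-acb sorted a b c)) (orderings-sorted-increasing a<c c<b)
... | tri< a<b _ _ | tri> _ _ c<b | tri> _ _ c<a =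
  subst (1 ≤_) (sym (trans (orderings-acb sorted a b c) (orderings-bac sorted a c b)))
    (orderings-sorted-increasing c<a a<b)
... | tri> _ _ b<a | tri< b<c _ _ | tri< a<c _ _ =
  subst (1 ≤_) (sym (orderings-bac sorted a b c)) (orderings-sorted-increasing b<a a<c)
... | tri> _ _ b<a | tri< b<c _ _ | tri> _ _ c<a =
  subst (1 ≤_) (sym (trans (orderings-bac sorted a b c) (orderings-acb sorted b a c)))
    (orderings-sorted-increasing b<c c<a)
... | tri> _ _ b<a | tri> _ _ c<b | _ =
  subst (1 ≤_) (sym (trans (orderings-bac sorted a b c)
                    (trans (orderings-acb sorted b a c) (orderings-bac sorted b c a))))
    (orderings-sorted-increasing c<b b<a)

module _ {D : Digraph n} (O : IsOriented D) where
  open IsOriented O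

  arc⇒≢ : ∀ {x y} → arc D x y ≡ true → x ≢ y
  arc⇒≢ {x} xy refl with trans (sym xy) (loopless x)
  ... | ()

  arc∧arc≡false : ∀ x y → arc D x y ∧ arc D y x ≡ false
  arc∧arc≡false x y with arc D x y in xy
  ... | false = refl
  ... | true = antisym x y (subst T (sym xy) _)

transitive : Digraph n → Fin n → Fin n → Fin n → ℕ
transitive D u w x = ⟦ arc D u w ∧ arc D u x ∧ arc D w x ⟧

sortedTT : Digraph n → Fin n → Fin n → Fin n → Bool
sortedTT D a b c = ⌊ a <? b ⌋ ∧ ⌊ b <? c ⌋ ∧ isTT D a b c

tt≡∑³ : (D : Digraph n) → tt D ≡ ∑³ (λ a b c → ⟦ sortedTT D a b c ⟧)
tt≡∑³ D = trans (sumV≡∑ (λ a → sumV (λ b → count (sortedTT D a b))))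
  (trans (sum-cong-≗ λ a → trans (sumV≡∑ (λ b → count (sortedTT D a b)))
                                 (sum-cong-≗ λ b → count≡∑ (sortedTT D a b)))
         (sym (∑³-unfold (λ a b c → ⟦ sortedTT D a b c ⟧))))

-- With these six arcs
-- read off a digraph D at vertices a, b, c, every quantity about 0, 1, 2 in triangle v
-- reduces to the corresponding one about a, b, c in D.
triangle : Vec Bool 6 → Digraph 3
triangle (ab ∷ ba ∷ ac ∷ ca ∷ bc ∷ cb ∷ []) = record { arc = arcs }
  where
  arcs : Fin 3 → Fin 3 → Bool
  arcs 0F 1F = ab
  arcs 1F 0F = ba
  arcs 0F 2F = ac
  arcs 2F 0F = ca
  arcs 1F 2F = bc
  arcs 2F 1F = cb
  arcs _ _ = false

OrientedTriangleBound : Vec Bool 6 → Set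
OrientedTriangleBound v =
  arc E 0F 1F ∧ arc E 1F 0F ≡ false → arc E 0F 2F ∧ arc E 2F 0F ≡ false →
  arc E 1F 2F ∧ arc E 2F 1F ≡ false →
  orderings (transitive E) 0F 1F 2F ≤ ⟦ isTT E 0F 1F 2F ⟧
  where E = triangle v

orientedTriangleBound? : Decidable OrientedTriangleBound
orientedTriangleBound? (ab ∷ ba ∷ ac ∷ ca ∷ bc ∷ cb ∷ []) =
  (ab ∧ ba Bool.≟ false) →-dec (ac ∧ ca Bool.≟ false) →-dec (bc ∧ cb Bool.≟ false) →-dec
  (_ ≤? _)

-- Checked by evaluation on all 64 digraphs on {0, 1, 2}.
orientedTriangleBound : ∀ v → OrientedTriangleBound v
orientedTriangleBound = from-yes (∀-Subset? orientedTriangleBound?)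

module _ {D : Digraph n} (O : IsOriented D) where

  orderings-transitive≤isTT : ∀ a b c → orderings (transitive D) a b c ≤ ⟦ isTT D a b c ⟧
  orderings-transitive≤isTT a b c =
    orientedTriangleBound (arc D a b ∷ arc D b a ∷ arc D a c ∷ arc D c a ∷ arc D b c ∷ arc D c b ∷ [])
      (arc∧arc≡false O a b) (arc∧arc≡false O a c) (arc∧arc≡false O b c)

  transitive≤*orderings-sorted : ∀ a b c →
    transitive D a b c ≤ transitive D a b c * orderings sorted a b c
  transitive≤*orderings-sorted a b c with arc D a b in ab | arc D a c in ac | arc D b c in bc
  ... | true | true | true = ≤-trans
    (orderings-sorted-pos (arc⇒≢ O ab) (arc⇒≢ O ac) (arc⇒≢ O bc))
    (≤-reflexive (sym (*-identityˡ _)))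
  ... | false | _ | _ = z≤n
  ... | true | false | _ = z≤n
  ... | true | true | false = z≤n

  sorted*orderings-transitive≤sortedTT : ∀ a b c →
    sorted a b c * orderings (transitive D) a b c ≤ ⟦ sortedTT D a b c ⟧
  sorted*orderings-transitive≤sortedTT a b c =
    subst (sorted a b c * orderings (transitive D) a b c ≤_)
      (cong ⟦_⟧ (∧-assoc ⌊ a <? b ⌋ ⌊ b <? c ⌋ (isTT D a b c)))
      (⟦⟧*-≤-⟦∧⟧ (⌊ a <? b ⌋ ∧ ⌊ b <? c ⌋) (isTT D a b c) (orderings-transitive≤isTT a b c))

  transitiveTriples≤tt : ∑³ (transitive D) ≤ tt D
  transitiveTriples≤tt = begin
    ∑³ (transitive D)
      ≤⟨ ∑³-mono-≤ transitive≤*orderings-sorted ⟩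
    ∑³ (λ a b c → transitive D a b c * orderings sorted a b c)
      ≡⟨ ∑³-*-orderings-comm (transitive D) sorted ⟩
    ∑³ (λ a b c → sorted a b c * orderings (transitive D) a b c)
      ≤⟨ ∑³-mono-≤ sorted*orderings-transitive≤sortedTT ⟩
    ∑³ (λ a b c → ⟦ sortedTT D a b c ⟧)
      ≡⟨ tt≡∑³ D ⟨
    tt D ∎
    where open ≤-Reasoning

outDeg : Digraph n → Fin n → ℕ
outDeg D u = count (arc D u)

commonOut : Digraph n → Fin n → Fin n → ℕ
commonOut D u w = count (λ x → arc D u x ∧ arc D w x)

outDeg≤commonOut+secondOutDeg : (D : Digraph n) {u w : Fin n} → arc D u w ≡ true →
  outDeg D w ≤ commonOut D u w + secondOutDeg D u
outDeg≤commonOut+secondOutDeg {n} D {u} {w} uw = begin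
  outDeg D w                                               ≡⟨ count≡∑ (arc D w) ⟩
  ∑[ x < n ] ⟦ arc D w x ⟧                                 ≤⟨ ∑-mono-≤ split ⟩
  ∑[ x < n ] (⟦ arc D u x ∧ arc D w x ⟧ + ⟦ inN⁺⁺ D u x ⟧)
    ≡⟨ ∑-distrib-+ (λ x → ⟦ arc D u x ∧ arc D w x ⟧) (λ x → ⟦ inN⁺⁺ D u x ⟧) ⟩
  ∑[ x < n ] ⟦ arc D u x ∧ arc D w x ⟧ + ∑[ x < n ] ⟦ inN⁺⁺ D u x ⟧
    ≡⟨ cong₂ _+_ (count≡∑ (λ x → arc D u x ∧ arc D w x)) (count≡∑ (inN⁺⁺ D u)) ⟨
  commonOut D u w + secondOutDeg D u                       ∎
  where
  open ≤-Reasoning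
  split : ∀ x → ⟦ arc D w x ⟧ ≤ ⟦ arc D u x ∧ arc D w x ⟧ + ⟦ inN⁺⁺ D u x ⟧
  split x with arc D w x in wx
  ... | false = z≤n
  ... | true with arc D u x
  ...   | true = s≤s z≤n
  ...   | false rewrite any-∈ (λ v → arc D u v ∧ arc D v x) (∈-allFin w) (cong₂ _∧_ uw wx) = ≤-refl

arcSum : Digraph n → (Fin n → Fin n → ℕ) → ℕ
arcSum {n} D h = ∑[ u < n ] ∑[ w < n ] (⟦ arc D u w ⟧ * h u w)

module _ (D : Digraph n) where

  arcSum-mono-≤ : {h k : Fin n → Fin n → ℕ} → (∀ u w → arc D u w ≡ true → h u w ≤ k u w) →
    arcSum D h ≤ arcSum D k
  arcSum-mono-≤ h≤k = ∑-mono-≤ λ u → ∑-mono-≤ λ w → ⟦⟧*-monoʳ-≤ (arc D u w) (h≤k u w)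

  arcSum-distrib-+ : (h k : Fin n → Fin n → ℕ) →
    arcSum D (λ u w → h u w + k u w) ≡ arcSum D h + arcSum D k
  arcSum-distrib-+ h k = trans
    (sum-cong-≗ λ u → trans (sum-cong-≗ λ w → *-distribˡ-+ ⟦ arc D u w ⟧ (h u w) (k u w))
                            (∑-distrib-+ (λ w → ⟦ arc D u w ⟧ * h u w) (λ w → ⟦ arc D u w ⟧ * k u w)))
    (∑-distrib-+ (λ u → ∑[ w < n ] (⟦ arc D u w ⟧ * h u w)) (λ u → ∑[ w < n ] (⟦ arc D u w ⟧ * k u w)))

  arcSum-head : (h : Fin n → ℕ) → arcSum D (λ _ w → h w) ≡ ∑[ w < n ] (inDeg D w * h w)
  arcSum-head h = trans (∑-comm (λ u w → ⟦ arc D u w ⟧ * h w)) (sum-cong-≗ λ w → begin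
    ∑[ u < n ] (⟦ arc D u w ⟧ * h w)  ≡⟨ *-distribʳ-sum (h w) (λ u → ⟦ arc D u w ⟧) ⟨
    (∑[ u < n ] ⟦ arc D u w ⟧) * h w  ≡⟨ cong (_* h w) (count≡∑ (λ u → arc D u w)) ⟨
    inDeg D w * h w                   ∎)
    where open ≡-Reasoning

  arcSum-tail : (h : Fin n → ℕ) → arcSum D (λ u _ → h u) ≡ ∑[ u < n ] (outDeg D u * h u)
  arcSum-tail h = sum-cong-≗ λ u →
    trans (sym (*-distribʳ-sum (h u) (λ w → ⟦ arc D u w ⟧))) (cong (_* h u) (sym (count≡∑ (arc D u))))

  numArcs≡arcSum : numArcs D ≡ arcSum D (λ _ _ → 1)
  numArcs≡arcSum = trans (sumV≡∑ (outDeg D)) (sum-cong-≗ λ u →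
    trans (count≡∑ (arc D u)) (sum-cong-≗ λ w → sym (*-identityʳ ⟦ arc D u w ⟧)))

  arcSum-commonOut : arcSum D (commonOut D) ≡ ∑³ (transitive D)
  arcSum-commonOut = trans (sum-cong-≗ λ u → sum-cong-≗ λ w →
    trans (cong (⟦ arc D u w ⟧ *_) (count≡∑ (λ x → arc D u x ∧ arc D w x)))
    (trans (*-distribˡ-sum ⟦ arc D u w ⟧ (λ x → ⟦ arc D u x ∧ arc D w x ⟧))
           (sum-cong-≗ λ x → sym (⟦∧⟧≡* (arc D u w) (arc D u x ∧ arc D w x)))))
    (sym (∑³-unfold (transitive D)))

  numArcs≤transitiveTriples : (∀ u → secondOutDeg D u < inDeg D u) → numArcs D ≤ ∑³ (transitive D)
  numArcs≤transitiveTriples notSullivan = +-cancelˡ-≤ S _ _ (begin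
    S + numArcs D                                       ≡⟨ cong (S +_) numArcs≡arcSum ⟩
    S + arcSum D (λ _ _ → 1)                            ≡⟨ arcSum-distrib-+ _ _ ⟨
    arcSum D (λ _ w → outDeg D w + 1)                   ≤⟨ arcSum-mono-≤ arcBound ⟩
    arcSum D (λ u w → commonOut D u w + inDeg D u)      ≡⟨ arcSum-distrib-+ _ _ ⟩
    arcSum D (commonOut D) + arcSum D (λ u _ → inDeg D u) ≡⟨ cong₂ _+_ arcSum-commonOut S≡ ⟩
    ∑³ (transitive D) + S                               ≡⟨ +-comm _ S ⟩
    S + ∑³ (transitive D)                               ∎)
    where
    open ≤-Reasoning
    S : ℕ
    S = arcSum D (λ _ w → outDeg D w)

    S≡ : arcSum D (λ u _ → inDeg D u) ≡ S
    S≡ = trans (arcSum-tail (inDeg D)) (trans (sum-cong-≗ λ v → *-comm (outDeg D v) _)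
               (sym (arcSum-head (outDeg D))))

    arcBound : ∀ u w → arc D u w ≡ true → outDeg D w + 1 ≤ commonOut D u w + inDeg D u
    arcBound u w uw = begin
      outDeg D w + 1
        ≤⟨ +-monoˡ-≤ 1 (outDeg≤commonOut+secondOutDeg D uw) ⟩
      commonOut D u w + secondOutDeg D u + 1
        ≡⟨ +-assoc (commonOut D u w) (secondOutDeg D u) 1 ⟩
      commonOut D u w + (secondOutDeg D u + 1)
        ≡⟨ cong (commonOut D u w +_) (+-comm (secondOutDeg D u) 1) ⟩
      commonOut D u w + suc (secondOutDeg D u)
        ≤⟨ +-monoʳ-≤ (commonOut D u w) (notSullivan u) ⟩
      commonOut D u w + inDeg D u ∎

theorem3p1 : {n : ℕ} (D : Digraph n) → IsOriented D →
    tt D < numArcs D → ∃ (λ (u : Fin n) → IsSullivan D u)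
theorem3p1 D O tt<|A| with any? (λ u → inDeg D u ≤? secondOutDeg D u)
... | yes sullivan = sullivan
... | no noSullivan = ⊥-elim (<⇒≱ tt<|A| (begin
  numArcs D          ≤⟨ numArcs≤transitiveTriples D (λ u → ≰⇒> (noSullivan ∘ (u ,_))) ⟩
  ∑³ (transitive D)  ≤⟨ transitiveTriples≤tt O ⟩
  tt D               ∎))
  where open ≤-Reasoning
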